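{- For all $n\in\mathbb{N}$ and $\pi=\pi_1\cdots\pi_n\in S_n$, \[\operatorname{sc}(\pi)=\max\big(\operatorname{sc}(\pi_1\cdots\pi_{n-1}),\ \operatorname{sc}(\pi_{\ge\pi_n})\big),\] where $\pi_{\ge\pi_n}$ denotes the subsequence of $\pi$ consisting of all entries greater than or equal to $\pi_n$.
   Context: West's stack-sorting map $s$ acts on a finite sequence of distinct integers as follows: read the input from left to right with an initially empty stack; repeatedly, if the input is nonempty and either the stack is empty or the top element of the stack is greater than the next input entry, push the next input entry onto the stack; otherwise pop the top element of the stack and append it to the output; stop when both input and stack are empty. For a finite sequence $\sigma$ of distinct integers (possibly empty), $\operatorname{sc}(\sigma)$ is the least integer $k\ge0$ such that $s^k(\sigma)$ is increasing. $S_n$ is the set of permutations of $[n]$ in one-line notation. -}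

module Defs where

open import Data.Nat using (ℕ; zero; suc; _+_; _*_; _<_; _≤_; _≤?_; _<?_)
open import Data.List using (List; []; _∷_; _++_; [_]; length; reverse)
open import Data.List.Relation.Unary.Linked using (Linked)
open import Data.Product using (_×_)
open import Relation.Nullary using (¬_; yes; no)

-- Machine state of West's stack-sorting procedure:
-- (remaining input, stack with top at head, output in reverse order).
record State : Set where
  constructor ⟨_,_,_⟩
  field
    input  : List ℕ
    stack  : List ℕ
    outRev : List ℕ

step : State → State
step ⟨ [] , [] , o ⟩ = ⟨ [] , [] , o ⟩
step ⟨ [] , t ∷ st , o ⟩ = ⟨ [] , st , t ∷ o ⟩
step ⟨ x ∷ xs , [] , o ⟩ = ⟨ xs , x ∷ [] , o ⟩
step ⟨ x ∷ xs , t ∷ st , o ⟩ with x <? t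
... | yes _ = ⟨ xs , x ∷ t ∷ st , o ⟩
... | no _  = ⟨ x ∷ xs , st , t ∷ o ⟩

iterate : ℕ → (State → State) → State → State
iterate zero    f s = s
iterate (suc k) f s = iterate k f (f s)

-- Each entry is pushed once and popped once, so 2·length σ steps reach
-- the terminal state (empty input and stack); further steps are identity.
s : List ℕ → List ℕ
s σ = reverse (State.outRev (iterate (2 * length σ) step ⟨ σ , [] , [] ⟩))

s^ : ℕ → List ℕ → List ℕ
s^ zero    σ = σ
s^ (suc k) σ = s^ k (s σ)

Increasing : List ℕ → Set
Increasing = Linked _<_

IsSc : List ℕ → ℕ → Set
IsSc σ k = Increasing (s^ k σ) × (∀ j → j < k → ¬ Increasing (s^ j σ))

range1 : ℕ → List ℕ
range1 zero    = []
range1 (suc n) = range1 n ++ [ suc n ]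

{-# OPTIONS --safe #-}
module Submission where

-- Write π = ρx. Placing x in front of a block of entries larger than x is preserved by a pass of
-- stack-sorting, so s^k(π) is s^k(ρ) with x inserted in this way; and restricting to the entries ≥ x
-- commutes with s, so s^k(π)_{≥x} = s^k(π_{≥x}). Such an insertion into a list is increasing iff the
-- list is and its entries ≥ x are. Hence s^k(π) is increasing iff s^k(ρ) and s^k(π_{≥x}) both are,
-- and since s fixes increasing sequences, the least such k is max(sc ρ, sc π_{≥x}).

open import Defs
open import Data.Nat using (ℕ; zero; suc; _+_; _*_; _<_; _≤_; _≤?_; _<?_; _⊔_; z≤n; s≤s)
open import Data.Nat.Properties
  using ( ≤-refl; ≤-trans; ≤-pred; <-trans; <-≤-trans; ≤-<-trans; <⇒≤; <⇒≢; ≤⇒≯; <⇒≱; ≰⇒>; ≮⇒≥; ≤∧≢⇒<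
        ; suc-injective; +-suc; *-suc; m≤m⊔n; m≤n⊔m; ⊔-lub)
open import Data.List using (List; []; _∷_; _++_; [_]; _∷ʳ_; _ʳ++_; length; reverse; filter; partition; applyUpTo)
open import Data.List.Properties
  using ( filter-accept; filter-reject; filter-all; filter-none; filter-++; filter-≐; partition-defn
        ; ʳ++-defn; reverse-involutive; ++-identityʳ; ++-assoc; applyUpTo-∷ʳ)
open import Data.List.Relation.Unary.All as All using (All; []; _∷_)
open import Data.List.Relation.Unary.All.Properties as All using (all-filter)
open import Data.List.Relation.Unary.Linked as Linked using (Linked; []; [-]; _∷_)
open import Data.List.Relation.Unary.Linked.Properties as Linked using (Linked⇒All)
open import Data.List.Relation.Unary.AllPairs as AllPairs using ()
open import Data.List.Relation.Unary.Unique.Propositional using (Unique)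
open import Data.List.Relation.Unary.Unique.Propositional.Properties as Unique using ()
open import Data.List.Relation.Binary.Permutation.Propositional
  using (_↭_; ↭-sym; ↭-trans; ↭-refl; ↭-prep; ↭⇒↭ₛ; ↭ₛ⇒↭; module PermutationReasoning)
open import Data.List.Relation.Binary.Permutation.Propositional.Properties
  using (++⁺; ++⁺ˡ; shift; shifts; ∷↭∷ʳ; All-resp-↭; ↭-length)
open import Relation.Binary.PropositionalEquality as ≡
  using (_≡_; ≢-sym; refl; sym; trans; cong; cong₂; subst; subst₂; _≗_; module ≡-Reasoning)
open import Data.List.Relation.Binary.Permutation.Setoid.Properties (≡.setoid ℕ)
  using (partition-↭) renaming (Unique-resp-↭ to Unique-resp-↭ₛ)
open import Data.Product using (∃; ∃-syntax; _×_; _,_; proj₁; swap; uncurry)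
open import Function.Base using (_∘_)
open import Function.Bundles using (_⇔_; mk⇔; Equivalence)
open import Relation.Nullary using (¬_; yes; no; does)
open import Data.Bool using (true; false)
open import Relation.Unary using (Pred; Decidable; _⊆_; ∁; _∩_)
open import Relation.Unary.Properties using (∁?; _∩?_)
open import Relation.Binary.Definitions using (_Respects_)

private variable
  x y t m : ℕ
  xs st l l′ A B σ : List ℕ

module _ {a p q} {X : Set a} {P : Pred X p} {Q : Pred X q} (P? : Decidable P) (Q? : Decidable Q) where

  filter-filter : filter P? ∘ filter Q? ≗ filter (P? ∩? Q?)
  filter-filter []       = refl
  filter-filter (x ∷ xs) with Q? x | P? x
  ... | yes _ | yes p = trans (filter-accept P? p) (cong (x ∷_) (filter-filter xs))
  ... | yes _ | no ¬p = trans (filter-reject P? ¬p) (filter-filter xs)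
  ... | no  _ | yes _ = filter-filter xs
  ... | no  _ | no  _ = filter-filter xs

module _ {a p q} {X : Set a} {P : Pred X p} {Q : Pred X q} (P? : Decidable P) (Q? : Decidable Q) where

  filter-filter-comm : filter P? ∘ filter Q? ≗ filter Q? ∘ filter P?
  filter-filter-comm xs = begin
    filter P? (filter Q? xs) ≡⟨ filter-filter P? Q? xs ⟩
    filter (P? ∩? Q?) xs     ≡⟨ filter-≐ (P? ∩? Q?) (Q? ∩? P?) (swap , swap) xs ⟩
    filter (Q? ∩? P?) xs     ≡⟨ filter-filter Q? P? xs ⟨
    filter Q? (filter P? xs) ∎
    where open ≡-Reasoning

  filter-filter-⊆ : P ⊆ Q → filter P? ∘ filter Q? ≗ filter P?
  filter-filter-⊆ P⊆Q xs =
    trans (filter-filter P? Q? xs) (filter-≐ (P? ∩? Q?) P? (proj₁ , λ p → p , P⊆Q p) xs)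

  filter-filter-⊇ : Q ⊆ P → filter P? ∘ filter Q? ≗ filter Q?
  filter-filter-⊇ Q⊆P xs = filter-all P? (All.map Q⊆P (all-filter Q? xs))

  filter-filter-disjoint : Q ⊆ ∁ P → ∀ xs → filter P? (filter Q? xs) ≡ []
  filter-filter-disjoint Q⊆∁P xs = filter-none P? (All.map Q⊆∁P (all-filter Q? xs))

filter-≤-++-filter->-↭ : ∀ x st → filter (_≤? x) st ++ filter (x <?_) st ↭ st
filter-≤-++-filter->-↭ x st = begin
  filter (_≤? x) st ++ filter (x <?_) st
    ≡⟨ cong (filter (_≤? x) st ++_) (filter-≐ (x <?_) (∁? (_≤? x)) (<⇒≱ , ≰⇒>) st) ⟩
  filter (_≤? x) st ++ filter (∁? (_≤? x)) st
    ≡⟨ cong (uncurry _++_) (partition-defn (_≤? x) st) ⟨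
  uncurry _++_ (partition (_≤? x) st)
    ↭⟨ ↭-sym (↭ₛ⇒↭ (partition-↭ (_≤? x) st)) ⟩
  st ∎
  where open PermutationReasoning

filter-≤-++-filter->-increasing : ∀ y → Increasing st → filter (_≤? y) st ++ filter (y <?_) st ≡ st
filter-≤-++-filter->-increasing {[]}     y _   = refl
filter-≤-++-filter->-increasing {a ∷ st} y inc with a ≤? y
... | yes a≤y = begin
  filter (_≤? y) (a ∷ st) ++ filter (y <?_) (a ∷ st)
    ≡⟨ cong₂ _++_ (filter-accept (_≤? y) a≤y) (filter-reject (y <?_) (≤⇒≯ a≤y)) ⟩
  a ∷ filter (_≤? y) st ++ filter (y <?_) st
    ≡⟨ cong (a ∷_) (filter-≤-++-filter->-increasing y (Linked.tail inc)) ⟩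
  a ∷ st ∎
  where open ≡-Reasoning
... | no a≰y = cong₂ _++_ (filter-none (_≤? y) (All.map <⇒≱ y<st)) (filter-all (y <?_) y<st)
  where y<st = Linked⇒All <-trans (≰⇒> a≰y) inc

∷-increasing : All (x <_) l → Increasing l → Increasing (x ∷ l)
∷-increasing []        _   = [-]
∷-increasing (x<y ∷ _) inc = x<y ∷ inc

linked-filter-tail : ∀ {a r p} {X : Set a} {R : X → X → Set r} {P : Pred X p} (P? : Decidable P) {x xs} →
                     Linked R (filter P? (x ∷ xs)) → Linked R (filter P? xs)
linked-filter-tail P? {x} lk with does (P? x)
... | true  = Linked.tail lk
... | false = lk

∷ʳ-increasing : Increasing σ → All (_< m) σ → Increasing (σ ∷ʳ m)
∷ʳ-increasing []          []          = [-]
∷ʳ-increasing [-]         (x<m ∷ [])  = x<m ∷ [-]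
∷ʳ-increasing (x<y ∷ inc) (_ ∷ σ<m)   = x<y ∷ ∷ʳ-increasing inc σ<m

Unique-resp-↭ : σ ↭ l → Unique σ → Unique l
Unique-resp-↭ = Unique-resp-↭ₛ ∘ ↭⇒↭ₛ

Least : ∀ {ℓ} → Pred ℕ ℓ → Pred ℕ ℓ
Least P k = P k × (∀ j → j < k → ¬ P j)

least-exists : ∀ {ℓ} {P : Pred ℕ ℓ} {n} → P Respects _≤_ → Decidable P → P n → ∃ (Least P)
least-exists {n = zero}  _    _  p = zero , p , λ _ ()
least-exists {n = suc n} mono P? p with P? n
... | yes pn = least-exists mono P? pn
... | no ¬pn = suc n , p , λ j j<1+n pj → ¬pn (mono (≤-pred j<1+n) pj)

least-∩ : ∀ {ℓ₁ ℓ₂} {Q : Pred ℕ ℓ₁} {R : Pred ℕ ℓ₂} {b c} → Q Respects _≤_ → R Respects _≤_ →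
          Least Q b → Least R c → Least (Q ∩ R) (b ⊔ c)
least-∩ {b = b} {c} monoQ monoR (qb , below-b) (rc , below-c) =
  (monoQ (m≤m⊔n b c) qb , monoR (m≤n⊔m b c) rc) ,
  λ j j<b⊔c (qj , rj) →
    <⇒≱ j<b⊔c (⊔-lub (≮⇒≥ (λ j<b → below-b j j<b qj)) (≮⇒≥ (λ j<c → below-c j j<c rj)))

Least-resp-⇔ : ∀ {ℓ₁ ℓ₂} {P : Pred ℕ ℓ₁} {Q : Pred ℕ ℓ₂} {k} →
               (∀ j → P j ⇔ Q j) → Least Q k → Least P k
Least-resp-⇔ P⇔Q (qk , below) =
  Equivalence.from (P⇔Q _) qk , λ j j<k pj → below j j<k (Equivalence.to (P⇔Q j) pj)

-- The stack-sorting map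

-- The stack is a list with its top first. For an increasing stack, reading x pops
-- exactly the entries ≤ x, which form a prefix of the stack, and then pushes x.
run : List ℕ → List ℕ → List ℕ
run []       st = st
run (x ∷ xs) st = filter (_≤? x) st ++ run xs (x ∷ filter (x <?_) st)

run-pop : t ≤ x → run (x ∷ xs) (t ∷ st) ≡ t ∷ run (x ∷ xs) st
run-pop {t} {x} {xs} t≤x =
  cong₂ (λ popped kept → popped ++ run xs (x ∷ kept))
        (filter-accept (_≤? x) t≤x) (filter-reject (x <?_) (≤⇒≯ t≤x))

run-push : All (x <_) st → run (x ∷ xs) st ≡ run xs (x ∷ st)
run-push {x} {xs = xs} x<st =
  cong₂ (λ popped kept → popped ++ run xs (x ∷ kept))
        (filter-none (_≤? x) (All.map <⇒≱ x<st)) (filter-all (x <?_) x<st)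

measure-after-push : ∀ h n k → h + 2 * suc n ≤ suc k → suc h + 2 * n ≤ k
measure-after-push h n k = ≤-pred ∘ subst (_≤ suc k) measure≡
  where
  open ≡-Reasoning
  measure≡ : h + 2 * suc n ≡ suc (suc h + 2 * n)
  measure≡ = begin
    h + 2 * suc n         ≡⟨ cong (h +_) (*-suc 2 n) ⟩
    h + suc (suc (2 * n)) ≡⟨ +-suc h _ ⟩
    suc (h + suc (2 * n)) ≡⟨ cong suc (+-suc h _) ⟩
    suc (suc h + 2 * n)   ∎

-- Each step lowers length st + 2 · length xs by one, so this many steps reach the halting state.
iterate-step : ∀ k xs st o → Increasing st → length st + 2 * length xs ≤ k →
               iterate k step ⟨ xs , st , o ⟩ ≡ ⟨ [] , [] , run xs st ʳ++ o ⟩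
iterate-step zero    []       []       o _   _       = refl
iterate-step (suc k) []       []       o _   _       = iterate-step k [] [] o [] z≤n
iterate-step (suc k) []       (t ∷ st) o inc (s≤s n) = iterate-step k [] st (t ∷ o) (Linked.tail inc) n
iterate-step (suc k) (x ∷ xs) []       o _   n       =
  iterate-step k xs [ x ] o [-] (measure-after-push 0 (length xs) k n)
iterate-step (suc k) (x ∷ xs) (t ∷ st) o inc n with x <? t
... | yes x<t =
  trans (iterate-step k xs (x ∷ t ∷ st) o (x<t ∷ inc) (measure-after-push (length (t ∷ st)) (length xs) k n))
        (cong (λ r → ⟨ [] , [] , r ʳ++ o ⟩) (sym (run-push {xs = xs} (Linked⇒All <-trans x<t inc))))
... | no x≮t =
  trans (iterate-step k (x ∷ xs) st (t ∷ o) (Linked.tail inc) (≤-pred n))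
        (cong (λ r → ⟨ [] , [] , r ʳ++ o ⟩) (sym (run-pop {xs = xs} (≮⇒≥ x≮t))))

s≡run : ∀ σ → s σ ≡ run σ []
s≡run σ = begin
  reverse (State.outRev (iterate (2 * length σ) step ⟨ σ , [] , [] ⟩))
    ≡⟨ cong (reverse ∘ State.outRev) (iterate-step (2 * length σ) σ [] [] [] ≤-refl) ⟩
  reverse (run σ [] ʳ++ [])     ≡⟨ cong reverse (ʳ++-defn (run σ [])) ⟩
  reverse (reverse (run σ []) ++ []) ≡⟨ cong reverse (++-identityʳ (reverse (run σ []))) ⟩
  reverse (reverse (run σ []))  ≡⟨ reverse-involutive _ ⟩
  run σ []                      ∎
  where open ≡-Reasoning

run-↭ : ∀ σ st → run σ st ↭ σ ++ st
run-↭ []       st = ↭-refl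
run-↭ (x ∷ xs) st = begin
  popped ++ run xs (x ∷ kept) ↭⟨ ++⁺ˡ popped (run-↭ xs (x ∷ kept)) ⟩
  popped ++ xs ++ x ∷ kept    ↭⟨ ++⁺ˡ popped (shift x xs kept) ⟩
  popped ++ x ∷ xs ++ kept    ↭⟨ shifts popped (x ∷ xs) ⟩
  x ∷ xs ++ popped ++ kept    ↭⟨ ↭-prep x (++⁺ˡ xs (filter-≤-++-filter->-↭ x st)) ⟩
  x ∷ xs ++ st                ∎
  where
  open PermutationReasoning
  popped = filter (_≤? x) st
  kept   = filter (x <?_) st

-- An entry is popped only by an entry at least as large, so entries < t never change the order
-- in which the entries ≥ t are output.
run-filter : ∀ t σ st → filter (t ≤?_) (run σ st) ≡ run (filter (t ≤?_) σ) (filter (t ≤?_) st)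
run-filter t []       st = refl
run-filter t (x ∷ xs) st with t ≤? x
... | yes t≤x = begin
  filter (t ≤?_) (filter (_≤? x) st ++ run xs (x ∷ filter (x <?_) st))
    ≡⟨ filter-++ (t ≤?_) (filter (_≤? x) st) _ ⟩
  filter (t ≤?_) (filter (_≤? x) st) ++ filter (t ≤?_) (run xs (x ∷ filter (x <?_) st))
    ≡⟨ cong₂ _++_ (filter-filter-comm (t ≤?_) (_≤? x) st) (run-filter t xs _) ⟩
  filter (_≤? x) (filter (t ≤?_) st) ++ run (filter (t ≤?_) xs) (filter (t ≤?_) (x ∷ filter (x <?_) st))
    ≡⟨ cong (λ k → filter (_≤? x) (filter (t ≤?_) st) ++ run (filter (t ≤?_) xs) k)
            (trans (filter-accept (t ≤?_) t≤x) (cong (x ∷_) (filter-filter-comm (t ≤?_) (x <?_) st))) ⟩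
  run (x ∷ filter (t ≤?_) xs) (filter (t ≤?_) st)
    ≡⟨ cong (λ ys → run ys (filter (t ≤?_) st)) (filter-accept (t ≤?_) t≤x) ⟨
  run (filter (t ≤?_) (x ∷ xs)) (filter (t ≤?_) st)
    ∎
  where open ≡-Reasoning
... | no t≰x = begin
  filter (t ≤?_) (filter (_≤? x) st ++ run xs (x ∷ filter (x <?_) st))
    ≡⟨ filter-++ (t ≤?_) (filter (_≤? x) st) _ ⟩
  filter (t ≤?_) (filter (_≤? x) st) ++ filter (t ≤?_) (run xs (x ∷ filter (x <?_) st))
    ≡⟨ cong₂ _++_ (filter-filter-disjoint (t ≤?_) (_≤? x) (λ a≤x t≤a → t≰x (≤-trans t≤a a≤x)) st)
                  (run-filter t xs _) ⟩
  run (filter (t ≤?_) xs) (filter (t ≤?_) (x ∷ filter (x <?_) st))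
    ≡⟨ cong (run (filter (t ≤?_) xs))
            (trans (filter-reject (t ≤?_) t≰x)
                   (filter-filter-⊆ (t ≤?_) (x <?_) (<-≤-trans (≰⇒> t≰x)) st)) ⟩
  run (filter (t ≤?_) xs) (filter (t ≤?_) st)
    ≡⟨ cong (λ ys → run ys (filter (t ≤?_) st)) (filter-reject (t ≤?_) t≰x) ⟨
  run (filter (t ≤?_) (x ∷ xs)) (filter (t ≤?_) st)
    ∎
  where open ≡-Reasoning

run-increasing : Increasing (x ∷ xs) → run xs [ x ] ≡ x ∷ xs
run-increasing [-]         = refl
run-increasing {x} {y ∷ ys} (x<y ∷ inc) =
  trans (run-pop {xs = ys} {st = []} (<⇒≤ x<y)) (cong (x ∷_) (run-increasing inc))

s-↭ : ∀ σ → s σ ↭ σ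
s-↭ σ = begin
  s σ       ≡⟨ s≡run σ ⟩
  run σ []  ↭⟨ run-↭ σ [] ⟩
  σ ++ []   ≡⟨ ++-identityʳ σ ⟩
  σ         ∎
  where open PermutationReasoning

s-filter : ∀ t σ → filter (t ≤?_) (s σ) ≡ s (filter (t ≤?_) σ)
s-filter t σ = begin
  filter (t ≤?_) (s σ)                ≡⟨ cong (filter (t ≤?_)) (s≡run σ) ⟩
  filter (t ≤?_) (run σ [])           ≡⟨ run-filter t σ [] ⟩
  run (filter (t ≤?_) σ) []           ≡⟨ s≡run (filter (t ≤?_) σ) ⟨
  s (filter (t ≤?_) σ)                ∎
  where open ≡-Reasoning

s-fixes-increasing : Increasing σ → s σ ≡ σ
s-fixes-increasing {[]}     _   = s≡run []
s-fixes-increasing {x ∷ xs} inc = trans (s≡run (x ∷ xs)) (run-increasing inc)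

s^-↭ : ∀ k σ → s^ k σ ↭ σ
s^-↭ zero    σ = ↭-refl
s^-↭ (suc k) σ = ↭-trans (s^-↭ k (s σ)) (s-↭ σ)

s^-filter : ∀ t k σ → filter (t ≤?_) (s^ k σ) ≡ s^ k (filter (t ≤?_) σ)
s^-filter t zero    σ = refl
s^-filter t (suc k) σ = trans (s^-filter t k (s σ)) (cong (s^ k) (s-filter t σ))

s^-fixes-increasing : ∀ k → Increasing σ → s^ k σ ≡ σ
s^-fixes-increasing zero    inc = refl
s^-fixes-increasing (suc k) inc = trans (cong (s^ k) (s-fixes-increasing inc)) (s^-fixes-increasing k inc)

s^-increasing-mono : ∀ σ → (λ k → Increasing (s^ k σ)) Respects _≤_
s^-increasing-mono σ {_} {k} z≤n inc = subst Increasing (sym (s^-fixes-increasing k inc)) inc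
s^-increasing-mono σ (s≤s j≤k) inc = s^-increasing-mono (s σ) j≤k inc

run-++-max : All (_≤ m) A → All (_≤ m) st → run (A ++ m ∷ B) st ≡ run A st ++ run B [ m ]
run-++-max {m} {[]} {st} {B} [] st≤m =
  cong₂ (λ popped kept → popped ++ run B (m ∷ kept))
        (filter-all (_≤? m) st≤m) (filter-none (m <?_) (All.map ≤⇒≯ st≤m))
run-++-max {m} {a ∷ A} {st} (a≤m ∷ A≤m) st≤m =
  trans (cong (filter (_≤? a) st ++_) (run-++-max A≤m (a≤m ∷ All.filter⁺ (a <?_) st≤m)))
        (sym (++-assoc (filter (_≤? a) st) _ _))

run-bottom-max : All (_< m) B → All (_< m) st → run B (st ∷ʳ m) ≡ run B st ∷ʳ m
run-bottom-max [] _ = refl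
run-bottom-max {m} {x ∷ B} {st} (x<m ∷ B<m) st<m = begin
  filter (_≤? x) (st ∷ʳ m) ++ run B (x ∷ filter (x <?_) (st ∷ʳ m))
    ≡⟨ cong₂ (λ popped kept → popped ++ run B (x ∷ kept)) popped≡ kept≡ ⟩
  filter (_≤? x) st ++ run B ((x ∷ filter (x <?_) st) ∷ʳ m)
    ≡⟨ cong (filter (_≤? x) st ++_) (run-bottom-max B<m (x<m ∷ All.filter⁺ (x <?_) st<m)) ⟩
  filter (_≤? x) st ++ run B (x ∷ filter (x <?_) st) ∷ʳ m
    ≡⟨ ++-assoc (filter (_≤? x) st) _ _ ⟨
  (filter (_≤? x) st ++ run B (x ∷ filter (x <?_) st)) ∷ʳ m
    ∎
  where
  open ≡-Reasoning
  popped≡ : filter (_≤? x) (st ∷ʳ m) ≡ filter (_≤? x) st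
  popped≡ = trans (filter-++ (_≤? x) st [ m ])
                  (trans (cong (filter (_≤? x) st ++_) (filter-reject (_≤? x) (<⇒≱ x<m))) (++-identityʳ _))
  kept≡ : filter (x <?_) (st ∷ʳ m) ≡ filter (x <?_) st ∷ʳ m
  kept≡ = trans (filter-++ (x <?_) st [ m ]) (cong (filter (x <?_) st ++_) (filter-accept (x <?_) x<m))

s-++-max : All (_≤ m) A → All (_< m) B → s (A ++ m ∷ B) ≡ (s A ++ s B) ∷ʳ m
s-++-max {m} {A} {B} A≤m B<m = begin
  s (A ++ m ∷ B)                 ≡⟨ s≡run (A ++ m ∷ B) ⟩
  run (A ++ m ∷ B) []            ≡⟨ run-++-max A≤m [] ⟩
  run A [] ++ run B [ m ]        ≡⟨ cong (run A [] ++_) (run-bottom-max B<m []) ⟩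
  run A [] ++ run B [] ∷ʳ m      ≡⟨ ++-assoc (run A []) (run B []) [ m ] ⟨
  (run A [] ++ run B []) ∷ʳ m    ≡⟨ cong₂ (λ sA sB → (sA ++ sB) ∷ʳ m) (s≡run A) (s≡run B) ⟨
  (s A ++ s B) ∷ʳ m              ∎
  where open ≡-Reasoning

s^-∷ʳ-max : ∀ k → All (_≤ m) σ → s^ k (σ ∷ʳ m) ≡ s^ k σ ∷ʳ m
s^-∷ʳ-max zero    σ≤m = refl
s^-∷ʳ-max {m} {σ} (suc k) σ≤m = begin
  s^ k (s (σ ∷ʳ m))        ≡⟨ cong (s^ k) (s-++-max σ≤m []) ⟩
  s^ k ((s σ ++ []) ∷ʳ m)  ≡⟨ cong (λ τ → s^ k (τ ∷ʳ m)) (++-identityʳ (s σ)) ⟩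
  s^ k (s σ ∷ʳ m)          ≡⟨ s^-∷ʳ-max k (All-resp-↭ (↭-sym (s-↭ σ)) σ≤m) ⟩
  s^ k (s σ) ∷ʳ m          ∎
  where open ≡-Reasoning

split-at-last-max : ∀ x xs →
                    ∃[ A ] ∃[ m ] ∃[ B ] (x ∷ xs ≡ A ++ m ∷ B × All (_≤ m) A × All (_< m) B)
split-at-last-max x []       = [] , x , [] , refl , [] , []
split-at-last-max x (y ∷ ys) with split-at-last-max y ys
... | A , m , B , eq , A≤m , B<m with x ≤? m
...   | yes x≤m = x ∷ A , m , B , cong (x ∷_) eq , x≤m ∷ A≤m , B<m
...   | no x≰m  = [] , x , y ∷ ys , refl , [] , subst (All (_< x)) (sym eq) (All.++⁺ A<x (m<x ∷ B<x))
  where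
  m<x = ≰⇒> x≰m
  A<x = All.map (λ a≤m → ≤-<-trans a≤m m<x) A≤m
  B<x = All.map (λ b<m → <-trans b<m m<x) B<m

s-ends-with-max : ∀ x xs → ∃[ τ ] ∃[ m ] (s (x ∷ xs) ≡ τ ∷ʳ m × All (_≤ m) τ)
s-ends-with-max x xs with split-at-last-max x xs
... | A , m , B , eq , A≤m , B<m =
  s A ++ s B , m , trans (cong s eq) (s-++-max A≤m B<m) ,
  All-resp-↭ (↭-sym (++⁺ (s-↭ A) (s-↭ B))) (All.++⁺ A≤m (All.map <⇒≤ B<m))

-- Each pass of s moves the largest entry to the end, where it stays; distinctness makes every
-- other entry strictly smaller.
s^-sorts-unique : ∀ n σ → length σ ≤ n → Unique σ → Increasing (s^ n σ)
s^-sorts-unique n       []       _         _ = subst Increasing (sym (s^-fixes-increasing n [])) []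
s^-sorts-unique (suc n) (x ∷ xs) (s≤s len) u with s-ends-with-max x xs
... | τ , m , sσ≡τm , τ≤m =
  subst Increasing (sym s^σ≡) (∷ʳ-increasing (s^-sorts-unique n τ lenτ (AllPairs.tail mτ-unique)) s^τ<m)
  where
  mτ↭σ : m ∷ τ ↭ x ∷ xs
  mτ↭σ = ↭-trans (∷↭∷ʳ m τ) (subst (_↭ x ∷ xs) sσ≡τm (s-↭ (x ∷ xs)))
  mτ-unique : Unique (m ∷ τ)
  mτ-unique = Unique-resp-↭ (↭-sym mτ↭σ) u
  s^τ<m : All (_< m) (s^ n τ)
  s^τ<m = All-resp-↭ (↭-sym (s^-↭ n τ))
            (All.zipWith (uncurry ≤∧≢⇒<) (τ≤m , All.map ≢-sym (AllPairs.head mτ-unique)))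
  lenτ : length τ ≤ n
  lenτ = subst (_≤ n) (sym (suc-injective (↭-length mτ↭σ))) len
  s^σ≡ : s^ (suc n) (x ∷ xs) ≡ s^ n τ ∷ʳ m
  s^σ≡ = trans (cong (s^ n) sσ≡τm) (s^-∷ʳ-max n τ≤m)

sc-exists : Unique σ → ∃ (IsSc σ)
sc-exists {σ} u =
  least-exists {n = length σ} (s^-increasing-mono σ) (λ k → Linked.linked? _<?_ (s^ k σ))
               (s^-sorts-unique (length σ) σ ≤-refl u)

-- Inserting a right-to-left minimum

data Insertion (y : ℕ) : List ℕ → List ℕ → Set where
  here  : All (y <_) l → Insertion y l (y ∷ l)
  there : Insertion y l l′ → Insertion y (x ∷ l) (x ∷ l′)

insertion-++ˡ : ∀ p → Insertion y l l′ → Insertion y (p ++ l) (p ++ l′)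
insertion-++ˡ []      i = i
insertion-++ˡ (_ ∷ p) i = there (insertion-++ˡ p i)

insertion-∷ʳ : ∀ σ → Insertion x σ (σ ∷ʳ x)
insertion-∷ʳ []      = here []
insertion-∷ʳ (_ ∷ σ) = there (insertion-∷ʳ σ)

-- An entry x ≥ y in front of y would survive the filter and precede y there.
increasing-filter-≥⇒< : Increasing (filter (y ≤?_) (x ∷ y ∷ l)) → x < y
increasing-filter-≥⇒< {y} {x} {l} inc with y ≤? x
... | no y≰x  = ≰⇒> y≰x
... | yes y≤x = Linked.head (subst Increasing filtered≡ inc)
  where
  filtered≡ : filter (y ≤?_) (x ∷ y ∷ l) ≡ x ∷ y ∷ filter (y ≤?_) l
  filtered≡ = trans (filter-accept (y ≤?_) y≤x) (cong (x ∷_) (filter-accept (y ≤?_) ≤-refl))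

increasing-insertion⁻ : Insertion y l l′ → Increasing l′ → Increasing l
increasing-insertion⁻ (here _)               inc               = Linked.tail inc
increasing-insertion⁻ (there (here []))      _                 = [-]
increasing-insertion⁻ (there (here (_ ∷ _))) (x<y ∷ y<z ∷ inc) = <-trans x<y y<z ∷ inc
increasing-insertion⁻ (there (there i))      (x<z ∷ inc)       = x<z ∷ increasing-insertion⁻ (there i) inc

increasing-insertion⁺ : Insertion y l l′ → Increasing l → Increasing (filter (y ≤?_) l′) → Increasing l′
increasing-insertion⁺ (here y<l)         inc _    = ∷-increasing y<l inc
increasing-insertion⁺ (there (here y<l)) inc incF =
  increasing-filter-≥⇒< incF ∷ ∷-increasing y<l (Linked.tail inc)
increasing-insertion⁺ {y} (there (there i)) (x<z ∷ inc) incF =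
  x<z ∷ increasing-insertion⁺ (there i) inc (linked-filter-tail (y ≤?_) incF)

increasing-insertion : Insertion y l l′ → Increasing l′ ⇔ (Increasing l × Increasing (filter (y ≤?_) l′))
increasing-insertion {y} i = mk⇔
  (λ inc → increasing-insertion⁻ i inc , Linked.filter⁺ (y ≤?_) <-trans inc)
  (uncurry (increasing-insertion⁺ i))

run-top-min : All (y <_) B → run B (y ∷ st) ≡ y ∷ run B st
run-top-min                 []        = refl
run-top-min {B = _ ∷ B} (y<x ∷ _) = run-pop {xs = B} (<⇒≤ y<x)

-- The first entry of B exceeds y, so it pops all stack entries ≤ y, which lie on top.
run-pop-below : All (y <_) B → Increasing st → run B st ≡ filter (_≤? y) st ++ run B (filter (y <?_) st)
run-pop-below {y} {[]}    {st} _ inc = sym (filter-≤-++-filter->-increasing y inc)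
run-pop-below {y} {x ∷ B} {st} (y<x ∷ _) inc = begin
  filter (_≤? x) st ++ run B (x ∷ filter (x <?_) st)
    ≡⟨ cong₂ (λ popped kept → popped ++ run B (x ∷ kept)) popped≡ kept≡ ⟩
  (filter (_≤? y) st ++ filter (_≤? x) (filter (y <?_) st)) ++ run B (x ∷ filter (x <?_) (filter (y <?_) st))
    ≡⟨ ++-assoc (filter (_≤? y) st) _ _ ⟩
  filter (_≤? y) st ++ run (x ∷ B) (filter (y <?_) st)
    ∎
  where
  open ≡-Reasoning
  popped≡ : filter (_≤? x) st ≡ filter (_≤? y) st ++ filter (_≤? x) (filter (y <?_) st)
  popped≡ = begin
    filter (_≤? x) st
      ≡⟨ cong (filter (_≤? x)) (filter-≤-++-filter->-increasing y inc) ⟨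
    filter (_≤? x) (filter (_≤? y) st ++ filter (y <?_) st)
      ≡⟨ filter-++ (_≤? x) (filter (_≤? y) st) _ ⟩
    filter (_≤? x) (filter (_≤? y) st) ++ filter (_≤? x) (filter (y <?_) st)
      ≡⟨ cong (_++ filter (_≤? x) (filter (y <?_) st))
              (filter-filter-⊇ (_≤? x) (_≤? y) (λ a≤y → ≤-trans a≤y (<⇒≤ y<x)) st) ⟩
    filter (_≤? y) st ++ filter (_≤? x) (filter (y <?_) st)
      ∎
  kept≡ : filter (x <?_) st ≡ filter (x <?_) (filter (y <?_) st)
  kept≡ = sym (filter-filter-⊆ (x <?_) (y <?_) (<-trans y<x) st)

run-insertion : Insertion y l l′ → Increasing st → Insertion y (run l st) (run l′ st)
run-insertion {y} {st = st} (here {l} y<l) inc =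
  subst₂ (Insertion y) (sym (run-pop-below y<l inc)) (cong (filter (_≤? y) st ++_) (sym (run-top-min y<l)))
         (insertion-++ˡ (filter (_≤? y) st) (here y<rest))
  where
  y<rest : All (y <_) (run l (filter (y <?_) st))
  y<rest = All-resp-↭ (↭-sym (run-↭ l _)) (All.++⁺ y<l (all-filter (y <?_) st))
run-insertion {st = st} (there {x = x} i) inc =
  insertion-++ˡ (filter (_≤? x) st)
    (run-insertion i (∷-increasing (all-filter (x <?_) st) (Linked.filter⁺ (x <?_) <-trans inc)))

s^-insertion : ∀ k → Insertion y l l′ → Insertion y (s^ k l) (s^ k l′)
s^-insertion zero i = i
s^-insertion {y} {l} {l′} (suc k) i =
  s^-insertion k (subst₂ (Insertion y) (sym (s≡run l)) (sym (s≡run l′)) (run-insertion i []))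

s^-∷ʳ-increasing⇔ : ∀ k σ x → Increasing (s^ k (σ ∷ʳ x)) ⇔
                    (Increasing (s^ k σ) × Increasing (s^ k (filter (x ≤?_) (σ ∷ʳ x))))
s^-∷ʳ-increasing⇔ k σ x =
  subst (λ π≥x → Increasing (s^ k (σ ∷ʳ x)) ⇔ (Increasing (s^ k σ) × Increasing π≥x))
        (s^-filter x k (σ ∷ʳ x))
        (increasing-insertion (s^-insertion k (insertion-∷ʳ σ)))

IsSc-∷ʳ : ∀ σ x {b c} → IsSc σ b → IsSc (filter (x ≤?_) (σ ∷ʳ x)) c → IsSc (σ ∷ʳ x) (b ⊔ c)
IsSc-∷ʳ σ x sc[σ] sc[σ≥x] =
  Least-resp-⇔ (λ k → s^-∷ʳ-increasing⇔ k σ x)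
               (least-∩ (s^-increasing-mono σ) (s^-increasing-mono (filter (x ≤?_) (σ ∷ʳ x)))
                        sc[σ] sc[σ≥x])

range1≡applyUpTo : ∀ n → range1 n ≡ applyUpTo suc n
range1≡applyUpTo zero    = refl
range1≡applyUpTo (suc n) = trans (cong (_∷ʳ suc n) (range1≡applyUpTo n)) (applyUpTo-∷ʳ suc n)

range1-unique : ∀ n → Unique (range1 n)
range1-unique n =
  subst Unique (sym (range1≡applyUpTo n)) (Unique.applyUpTo⁺₁ suc n (λ i<j _ → <⇒≢ (s≤s i<j)))

lemma5p5 : (n : ℕ) (ρ : List ℕ) (x : ℕ) → (ρ ∷ʳ x) ↭ range1 n →
    ∃ λ a → ∃ λ b → ∃ λ c →
      IsSc (ρ ∷ʳ x) a × IsSc ρ b × IsSc (filter (x ≤?_) (ρ ∷ʳ x)) c × a ≡ b ⊔ c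
lemma5p5 n ρ x π↭ with sc-exists ρ-unique | sc-exists (Unique.filter⁺ (x ≤?_) π-unique)
  where
  π-unique : Unique (ρ ∷ʳ x)
  π-unique = Unique-resp-↭ (↭-sym π↭) (range1-unique n)
  ρ-unique : Unique ρ
  ρ-unique = AllPairs.tail (Unique-resp-↭ (↭-sym (∷↭∷ʳ x ρ)) π-unique)
... | b , sc[ρ] | c , sc[π≥x] = b ⊔ c , b , c , IsSc-∷ʳ ρ x sc[ρ] sc[π≥x] , sc[ρ] , sc[π≥x] , refl
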